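{- Let $(P,\leq)$ be a poset and $(\mathscr{A}(P),\leqq)$ its antichain completion. If $(\mathscr{A}(P),\leqq)$ is a lattice, then $(P,\leq)$ is a meet-multisemilattice. Moreover, if $(\mathscr{A}(P),\leqq)$ has a greatest element, then $P=\downarrow\max(P)$.
   Context: $\mathscr{A}(P)$ is the set of all antichains of $(P,\leq)$, ordered by $A\leqq B$ iff $\downarrow A\subseteq\downarrow B$, where $\downarrow X=\{y\in P\mid\exists x\in X,\ y\leq x\}$. For $S\subseteq P$, $S^\ell$ is the set of lower bounds of $S$ and $\max(X)$ the set of maximal elements of $X$. $S$ has all its multi-infima if $S^\ell=\downarrow\max(S^\ell)$. A meet-multisemilattice is a poset in which every nonempty finite subset has all its multi-infima. -}

module Defs where

open import Level using (Level; _⊔_; suc)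
open import Relation.Binary.Bundles using (Poset)
open import Relation.Unary using (Pred; _∈_; _⊆_; U)
open import Data.Product using (Σ; ∃; _×_; _,_)
open import Data.List using (List; _∷_)
open import Data.List.Membership.Propositional renaming (_∈_ to _∈ₗ_)

module AntichainCompletion {c ℓ₁ ℓ₂ : Level} (P : Poset c ℓ₁ ℓ₂) where
  open Poset P

  Subset : Set (suc (c ⊔ ℓ₁ ⊔ ℓ₂))
  Subset = Pred Carrier (c ⊔ ℓ₁ ⊔ ℓ₂)

  IsAntichain : Subset → Set (c ⊔ ℓ₁ ⊔ ℓ₂)
  IsAntichain A = ∀ {a b} → a ∈ A → b ∈ A → a ≤ b → a ≈ b

  Antichain : Set (suc (c ⊔ ℓ₁ ⊔ ℓ₂))
  Antichain = Σ Subset IsAntichain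

  ↓_ : ∀ {a} → Pred Carrier a → Pred Carrier (c ⊔ ℓ₂ ⊔ a)
  (↓ X) y = ∃ λ x → x ∈ X × y ≤ x

  max : ∀ {a} → Pred Carrier a → Pred Carrier (c ⊔ ℓ₁ ⊔ ℓ₂ ⊔ a)
  max X x = x ∈ X × (∀ {y} → y ∈ X → x ≤ y → x ≈ y)

  _≦_ : Antichain → Antichain → Set (c ⊔ ℓ₁ ⊔ ℓ₂)
  (A , _) ≦ (B , _) = ↓ A ⊆ ↓ B

  IsJoin : Antichain → Antichain → Antichain → Set (suc (c ⊔ ℓ₁ ⊔ ℓ₂))
  IsJoin A B J = A ≦ J × B ≦ J × (∀ C → A ≦ C → B ≦ C → J ≦ C)

  IsMeet : Antichain → Antichain → Antichain → Set (suc (c ⊔ ℓ₁ ⊔ ℓ₂))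
  IsMeet A B M = M ≦ A × M ≦ B × (∀ C → C ≦ A → C ≦ B → C ≦ M)

  IsLattice : Set (suc (c ⊔ ℓ₁ ⊔ ℓ₂))
  IsLattice = ∀ A B → (∃ λ J → IsJoin A B J) × (∃ λ M → IsMeet A B M)

  HasGreatest : Set (suc (c ⊔ ℓ₁ ⊔ ℓ₂))
  HasGreatest = ∃ λ T → ∀ A → A ≦ T

  -- finite subsets given by lists; S^ℓ = lower bounds
  lower : List Carrier → Pred Carrier (c ⊔ ℓ₂)
  lower S y = ∀ {x} → x ∈ₗ S → y ≤ x

  HasAllMultiInfima : List Carrier → Set (c ⊔ ℓ₁ ⊔ ℓ₂)
  HasAllMultiInfima S = lower S ⊆ ↓ (max (lower S)) × ↓ (max (lower S)) ⊆ lower S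

  IsMeetMultisemilattice : Set (c ⊔ ℓ₁ ⊔ ℓ₂)
  IsMeetMultisemilattice = ∀ (s : Carrier) (S : List Carrier) → HasAllMultiInfima (s ∷ S)

  EveryElementBelowMaximal : Set (c ⊔ ℓ₁ ⊔ ℓ₂)
  EveryElementBelowMaximal = ∀ x → x ∈ ↓ (max U)

module Submission where

-- Both statements are instances of one observation about an
-- antichain A and a set L with L ⊆ ↓A and A ⊆ L: every element of A is then
-- maximal in L (anything above a ∈ A inside L lies below some a' ∈ A, and the
-- antichain property forces a ≈ a'), hence L ⊆ ↓ max(L).
--
-- * Greatest element T of 𝒜(P): take L = P and A = T; P ⊆ ↓T because every
--   principal antichain {x} lies below T.
-- * Lattice: binary meets in 𝒜(P) give, by induction on the list, an
--   infimum M of the principal antichains {s}, {s₁}, …, {sₙ}.  Comparing M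
--   with principal antichains shows S^ℓ ⊆ ↓M and M ⊆ S^ℓ, so the observation
--   yields S^ℓ ⊆ ↓ max(S^ℓ); the reverse inclusion holds because S^ℓ is a
--   down-set.

open import Defs
open import Level using (Level; Lift; lift; _⊔_) renaming (suc to lsuc)
open import Relation.Binary.Bundles using (Poset)
open import Relation.Binary.PropositionalEquality using () renaming (refl to ≡-refl)
open import Relation.Unary using (Pred; _∈_; _⊆_)
open import Data.Product using (_×_; _,_; ∃; proj₁)
open import Data.List using (List; _∷_; [])
open import Data.List.Relation.Unary.Any using (here; there)
open import Data.List.Membership.Propositional using () renaming (_∈_ to _∈ₗ_)
open import Data.Unit using (tt)

module _ {c ℓ₁ ℓ₂ : Level} (P : Poset c ℓ₁ ℓ₂) where
  open Poset P
  open AntichainCompletion P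

  antichain-elements-maximal : ∀ {a} {L : Pred Carrier a} (A : Antichain) →
    L ⊆ ↓ proj₁ A → ∀ {m} → m ∈ proj₁ A → L m → max L m
  antichain-elements-maximal {L = L} (A , isAntichain) L⊆↓A {m} m∈A m∈L = m∈L , maximal
    where
    maximal : ∀ {z} → L z → m ≤ z → m ≈ z
    maximal z∈L m≤z with L⊆↓A z∈L
    ... | m′ , m′∈A , z≤m′ =
      antisym m≤z (≤-respʳ-≈ (Eq.sym (isAntichain m∈A m′∈A (trans m≤z z≤m′))) z≤m′)

  below-maximal : ∀ {a} {L : Pred Carrier a} (A : Antichain) →
    L ⊆ ↓ proj₁ A → proj₁ A ⊆ L → L ⊆ ↓ max L
  below-maximal A L⊆↓A A⊆L y∈L with L⊆↓A y∈L
  ... | m , m∈A , y≤m = m , antichain-elements-maximal A L⊆↓A m∈A (A⊆L m∈A) , y≤m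

  _∈↓_ : Carrier → Antichain → Set (c ⊔ ℓ₁ ⊔ ℓ₂)
  y ∈↓ A = (↓ proj₁ A) y

  principal : Carrier → Antichain
  principal x = (λ y → Lift (c ⊔ ℓ₂) (y ≈ x)) ,
                λ { (lift a≈x) (lift b≈x) _ → Eq.trans a≈x (Eq.sym b≈x) }

  ↓principal⇒≤ : ∀ {x y} → y ∈↓ principal x → y ≤ x
  ↓principal⇒≤ (z , lift z≈x , y≤z) = ≤-respʳ-≈ z≈x y≤z

  ≤⇒↓principal : ∀ {x y} → y ≤ x → y ∈↓ principal x
  ≤⇒↓principal {x} y≤x = x , lift Eq.refl , y≤x

  principal-≦⇒∈↓ : ∀ {y} (A : Antichain) → principal y ≦ A → y ∈↓ A
  principal-≦⇒∈↓ A y≦A = y≦A (≤⇒↓principal refl)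

  IsInfimum : List Carrier → Antichain → Set (lsuc (c ⊔ ℓ₁ ⊔ ℓ₂))
  IsInfimum xs M = (∀ {x} → x ∈ₗ xs → M ≦ principal x)
                 × (∀ C → (∀ {x} → x ∈ₗ xs → C ≦ principal x) → C ≦ M)

  infimum : IsLattice → ∀ s S → ∃ (IsInfimum (s ∷ S))
  infimum lattice s [] =
    principal s , (λ { (here ≡-refl) → λ p → p }) , (λ C below → below (here ≡-refl))
  infimum lattice s (x ∷ S) with infimum lattice x S
  ... | M , M≦xS , M-greatest with lattice (principal s) M
  ... | _ , (N , N≦s , N≦M , N-greatest) = N , N-below , N-greatestBelow
    where
    N-below : ∀ {z} → z ∈ₗ s ∷ x ∷ S → N ≦ principal z
    N-below (here ≡-refl) = N≦s
    N-below (there z∈xS) = λ p → M≦xS z∈xS (N≦M p)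
    N-greatestBelow : ∀ C → (∀ {z} → z ∈ₗ s ∷ x ∷ S → C ≦ principal z) → C ≦ N
    N-greatestBelow C below =
      N-greatest C (below (here ≡-refl)) (M-greatest C (λ z∈xS → below (there z∈xS)))

  lower⊆↓infimum : ∀ {xs} (M : Antichain) → IsInfimum xs M → lower xs ⊆ ↓ proj₁ M
  lower⊆↓infimum M (_ , M-greatest) y∈lower =
    principal-≦⇒∈↓ M (M-greatest (principal _)
      (λ x∈xs p → ≤⇒↓principal (trans (↓principal⇒≤ p) (y∈lower x∈xs))))

  infimum⊆lower : ∀ {xs} (M : Antichain) → IsInfimum xs M → proj₁ M ⊆ lower xs
  infimum⊆lower M (M≦xs , _) {m} m∈M x∈xs = ↓principal⇒≤ (M≦xs x∈xs (m , m∈M , refl))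

  ↓max-lower⊆lower : ∀ xs → ↓ max (lower xs) ⊆ lower xs
  ↓max-lower⊆lower xs (m , (m∈lower , _) , y≤m) x∈xs = trans y≤m (m∈lower x∈xs)

  -- First claim: S^ℓ is sandwiched between the infimum M and ↓M.
  lattice⇒meetMultisemilattice : IsLattice → IsMeetMultisemilattice
  lattice⇒meetMultisemilattice lattice s S with infimum lattice s S
  ... | M , isInf =
    below-maximal M (lower⊆↓infimum M isInf) (infimum⊆lower M isInf) , ↓max-lower⊆lower (s ∷ S)

  -- Second claim: P is sandwiched between the greatest antichain T and ↓T.
  greatest⇒belowMaximal : HasGreatest → EveryElementBelowMaximal
  greatest⇒belowMaximal (T , T-greatest) x =
    below-maximal T (λ {y} _ → principal-≦⇒∈↓ T (T-greatest (principal y))) (λ _ → tt) tt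

proposition8p3 : ∀ {c ℓ₁ ℓ₂ : Level} (P : Poset c ℓ₁ ℓ₂) →
    let open AntichainCompletion P in
    (IsLattice → IsMeetMultisemilattice) × (HasGreatest → EveryElementBelowMaximal)
proposition8p3 P = lattice⇒meetMultisemilattice P , greatest⇒belowMaximal P
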